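{- Let $T$ be a tree and let $S$ be a labeling of $T$ such that $(T,S)\in\mathscr{T}$. Then $\gamma_{t2}(T)=\frac{2[n(T)-l(T)+2]}{5}$.
   Context: For a graph $G$ without isolated vertices, a set $D\subseteq V(G)$ is a semitotal dominating set if every vertex of $V(G)\setminus D$ is adjacent to a vertex of $D$, and every vertex of $D$ is at distance at most $2$ from some other vertex of $D$; $\gamma_{t2}(G)$ is the minimum cardinality of such a set. For a tree $T$, $n(T)$ is its number of vertices and $l(T)$ its number of leaves. A labeling of a tree $T$ is a partition $S=(S_A,S_B,S_C)$ of $V(T)$; the status $\mathrm{sta}(v)$ of a vertex $v$ is the letter $x\in\{A,B,C\}$ with $v\in S_x$, and $(T,S)$ is called a labeled tree. The family $\mathscr{T}$ of labeled trees is the smallest family that (i) contains $(P_5,S')$, where $S'$ gives the two support vertices (neighbors of leaves) of the path $P_5$ status $A$, the two leaves status $C$, and the center vertex status $B$; and (ii) is closed under the following two operations applied to a labeled tree $(T',S^*)$ in the family: Operation $\mathscr{O}_1$: choose a vertex $v$ with $\mathrm{sta}(v)=A$, add a new vertex $u$ and the edge $uv$, and give $u$ status $C$. Operation $\mathscr{O}_2$: choose a vertex $v$ with $\mathrm{sta}(v)=C$ and degree one, add a new path $u_1u_2u_3u_4u_5$ and the edge $u_1v$, and set $\mathrm{sta}(u_1)=\mathrm{sta}(u_5)=C$, $\mathrm{sta}(u_2)=\mathrm{sta}(u_4)=A$, $\mathrm{sta}(u_3)=B$ (all other statuses unchanged). -}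

module Defs where

open import Data.Nat using (ℕ; zero; suc; _+_; _*_; _∸_; _≤_)
open import Data.Fin using (Fin; zero; suc; inject₁; fromℕ; _↑ˡ_; _↑ʳ_; _≟_)
open import Data.Fin.Subset using (Subset; _∈_; _∉_; ∣_∣)
open import Data.Fin.Permutation using (Permutation; _⟨$⟩ʳ_; _⟨$⟩ˡ_)
open import Data.List using (List; []; _∷_; map; _++_; allFin; length; filter)
import Data.List.Membership.Propositional as LM
open import Data.Product using (_×_; _,_; Σ; ∃; ∃-syntax; proj₁; proj₂)
open import Data.Sum using (_⊎_)
open import Relation.Binary.PropositionalEquality using (_≡_; _≢_)
open import Relation.Nullary using (Dec; yes; no)
open import Relation.Nullary.Decidable using (⌊_⌋)
open import Data.Bool using (Bool; true; false; _∨_)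

Edges : ℕ → Set
Edges n = List (Fin n × Fin n)

Adj : ∀ {n} → Edges n → Fin n → Fin n → Set
Adj E u v = (u , v) LM.∈ E ⊎ (v , u) LM.∈ E

deg : ∀ {n} → Edges n → Fin n → ℕ
deg [] v = zero
deg ((a , b) ∷ E) v with ⌊ a ≟ v ⌋ ∨ ⌊ b ≟ v ⌋
... | true  = suc (deg E v)
... | false = deg E v

leaves : ∀ {n} → Edges n → ℕ
leaves {n} E = length (filter (λ v → deg E v Data.Nat.≟ 1) (allFin n))

IsSemitotalDom : ∀ {n} → Edges n → Subset n → Set
IsSemitotalDom {n} E D =
  (∀ v → v ∉ D → ∃[ u ] (u ∈ D × Adj E v u)) ×
  (∀ v → v ∈ D → ∃[ w ] (w ∈ D × w ≢ v ×
       (Adj E v w ⊎ ∃[ x ] (Adj E v x × Adj E x w))))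

IsGammaT2 : ∀ {n} → Edges n → ℕ → Set
IsGammaT2 {n} E k =
  (∃[ D ] (IsSemitotalDom E D × ∣ D ∣ ≡ k)) ×
  (∀ D → IsSemitotalDom E D → k ≤ ∣ D ∣)

data Status : Set where
  A B C : Status

Labeling : ℕ → Set
Labeling n = Fin n → Status

P5 : Edges 5
P5 = (zero , suc zero) ∷ (suc zero , suc (suc zero)) ∷
     (suc (suc zero) , suc (suc (suc zero))) ∷
     (suc (suc (suc zero)) , suc (suc (suc (suc zero)))) ∷ []

P5lab : Labeling 5
P5lab zero = C
P5lab (suc zero) = A
P5lab (suc (suc zero)) = B
P5lab (suc (suc (suc zero))) = A
P5lab (suc (suc (suc (suc zero)))) = C

mapE : ∀ {m n} → (Fin m → Fin n) → Edges m → Edges n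
mapE f = map (λ e → f (proj₁ e) , f (proj₂ e))

O1E : ∀ {n} → Edges n → Fin n → Edges (suc n)
O1E {n} E v = (fromℕ n , inject₁ v) ∷ mapE inject₁ E

O1L : ∀ {n} → Labeling n → Labeling (suc n)
O1L {n} S i with Data.Fin.toℕ i Data.Nat.<? n
... | yes p = S (Data.Fin.fromℕ< p)
... | no _  = C

-- Operation O2: new path u1..u5 = raise n (0..4), u1 attached to v
O2E : ∀ {n} → Edges n → Fin n → Edges (n + 5)
O2E {n} E v = (n ↑ʳ zero , v ↑ˡ 5) ∷ mapE (n ↑ʳ_) P5 ++ mapE (_↑ˡ 5) E

O2L : ∀ {n} → Labeling n → Labeling (n + 5)
O2L {n} S i = Data.Sum.[ S , P5lab ] (Data.Fin.splitAt n i)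

permE : ∀ {n} → Permutation n n → Edges n → Edges n
permE σ = mapE (σ ⟨$⟩ʳ_)

permL : ∀ {n} → Permutation n n → Labeling n → Labeling n
permL σ S i = S (σ ⟨$⟩ˡ i)

data InFam : (n : ℕ) → Edges n → Labeling n → Set where
  base : InFam 5 P5 P5lab
  op1  : ∀ {n E S} → InFam n E S → (v : Fin n) → S v ≡ A →
         InFam (suc n) (O1E E v) (O1L S)
  op2  : ∀ {n E S} → InFam n E S → (v : Fin n) → S v ≡ C → deg E v ≡ 1 →
         InFam (n + 5) (O2E E v) (O2L S)
  iso  : ∀ {n E S} → InFam n E S → (σ : Permutation n n) →
         InFam n (permE σ E) (permL σ S)

module Submission where

-- Let m be the number of P5-blocks used to build (T,S).  The A-vertices form a semitotal
-- dominating set of size 2m: every other vertex has an A-neighbour, and the two A-vertices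
-- of a block are at distance 2.  Conversely every semitotal dominating set is
-- "A/B-dominating" (it dominates the A-vertices, and its B-vertices have partners within
-- distance 2, via an A-vertex at distance 2), and every A/B-dominating set has at least
-- 2m vertices: the inner vertices of a block only see their block, which forces two
-- vertices per block (P5Block), and a leaf added by O1 can be folded into its support
-- vertex.  Finally n + 2 = 5m + l, so 5·2m = 2(n + 2 − l).

open import Defs
open import Data.Nat using (ℕ; zero; suc; _+_; _*_; _∸_; _≤_; _<_; _<?_; z≤n; s≤s) renaming (_≟_ to _≟ℕ_)
open import Data.Nat.Properties
  using (+-comm; +-assoc; +-identityʳ; +-suc; *-suc; *-assoc; m+n∸n≡m; m≤m+n; m≤n+m; +-mono-≤;
         +-monoʳ-≤; +-cancelʳ-≤; ≤-trans; ≤-reflexive; ≤-refl; <⇒≢; <-irrefl;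
         +-0-commutativeMonoid; module ≤-Reasoning)
open import Data.Bool using (Bool; true; false; _∨_; if_then_else_)
open import Data.Bool.Properties using (∨-identityʳ; ∨-zeroʳ)
open import Data.Fin using (Fin; zero; suc; inject₁; fromℕ; _↑ˡ_; _↑ʳ_; _≟_; toℕ; splitAt)
open import Data.Fin.Patterns using (0F; 1F; 2F; 3F; 4F)
open import Data.Fin.Properties
  using (suc-injective; inject₁-injective; fromℕ≢inject₁; ↑ˡ-injective; ↑ʳ-injective;
         toℕ-↑ˡ; toℕ-↑ʳ; toℕ<n; splitAt-↑ˡ; splitAt-↑ʳ; splitAt⁻¹-↑ˡ; splitAt⁻¹-↑ʳ;
         toℕ-inject₁; toℕ-fromℕ; toℕ-fromℕ<; toℕ-injective)
open import Data.Fin.Permutation using (Permutation; _⟨$⟩ʳ_; _⟨$⟩ˡ_; inverseˡ; inverseʳ)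
open import Data.Fin.Subset using (Subset; ∣_∣; _∈_; _∉_)
open import Data.Vec using ([]; _∷_; lookup; tabulate)
open import Data.Vec.Properties using (lookup∘tabulate; []=⇒lookup; lookup⇒[]=)
open import Data.List using ([]; _∷_; _++_; filter; length) renaming (tabulate to listTabulate)
open import Data.List.Membership.Propositional.Properties using (∈-map⁺; ∈-map⁻; ∈-++⁺ˡ; ∈-++⁺ʳ; ∈-++⁻)
open import Data.List.Relation.Unary.Any using (here; there)
open import Data.Product using (_×_; _,_; ∃-syntax)
open import Data.Sum using (_⊎_; inj₁; inj₂)
open import Data.Empty using (⊥-elim)
open import Function using (_∘_; id)
open import Function.Definitions using (Injective)
open import Relation.Binary.PropositionalEquality
open import Relation.Nullary using (Dec; yes; no; does)
open import Relation.Nullary.Decidable using (⌊_⌋)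
open import Algebra.Properties.CommutativeMonoid.Sum +-0-commutativeMonoid
  using (sum; sum-cong-≗; sum-init-last; sum-permute)

infixr 5 _∙_
_∙_ : ∀ {A : Set} {x y z : A} → x ≡ y → y ≡ z → x ≡ z
_∙_ = trans

bit : Bool → ℕ
bit true  = 1
bit false = 0

false≢true : false ≢ true
false≢true ()

card : ∀ {n} → (Fin n → Bool) → ℕ
card χ = sum (bit ∘ χ)

bit-∨ : ∀ x y → bit (x ∨ y) ≤ bit x + bit y
bit-∨ true  y = s≤s z≤n
bit-∨ false y = ≤-refl

sum-↑ : ∀ m {k} (f : Fin (m + k) → ℕ) → sum f ≡ sum (f ∘ (_↑ˡ k)) + sum (f ∘ (m ↑ʳ_))
sum-↑ zero    f = refl
sum-↑ (suc m) f = trans (cong (f zero +_) (sum-↑ m (f ∘ suc))) (sym (+-assoc (f zero) _ _))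

sum-agree-except : ∀ {n} (f g : Fin n → ℕ) v → (∀ i → i ≢ v → f i ≡ g i) →
                   sum f + g v ≡ sum g + f v
sum-agree-except f g zero agree = begin
  f zero + sum (f ∘ suc) + g zero   ≡⟨ cong (λ s → f zero + s + g zero) tails ⟩
  f zero + sum (g ∘ suc) + g zero   ≡⟨ +-comm (f zero + sum (g ∘ suc)) (g zero) ⟩
  g zero + (f zero + sum (g ∘ suc)) ≡⟨ cong (g zero +_) (+-comm (f zero) _) ⟩
  g zero + (sum (g ∘ suc) + f zero) ≡⟨ sym (+-assoc (g zero) _ _) ⟩
  g zero + sum (g ∘ suc) + f zero   ∎
  where
  open ≡-Reasoning
  tails : sum (f ∘ suc) ≡ sum (g ∘ suc)
  tails = sum-cong-≗ (λ i → agree (suc i) λ ())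
sum-agree-except f g (suc v) agree = begin
  f zero + sum (f ∘ suc) + g (suc v)   ≡⟨ +-assoc (f zero) _ _ ⟩
  f zero + (sum (f ∘ suc) + g (suc v)) ≡⟨ cong₂ _+_ (agree zero λ ()) tails ⟩
  g zero + (sum (g ∘ suc) + f (suc v)) ≡⟨ sym (+-assoc (g zero) _ _) ⟩
  g zero + sum (g ∘ suc) + f (suc v)   ∎
  where
  open ≡-Reasoning
  tails : sum (f ∘ suc) + g (suc v) ≡ sum (g ∘ suc) + f (suc v)
  tails = sum-agree-except (f ∘ suc) (g ∘ suc) v (λ i i≢v → agree (suc i) (i≢v ∘ suc-injective))

sum-single-≤ : ∀ {n} (f : Fin n → ℕ) x → f x ≤ sum f
sum-single-≤ f zero    = m≤m+n _ _
sum-single-≤ f (suc x) = ≤-trans (sum-single-≤ (f ∘ suc) x) (m≤n+m _ (f zero))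

sum-pair-≤ : ∀ {n} (f : Fin n → ℕ) x y → x ≢ y → f x + f y ≤ sum f
sum-pair-≤ f zero    zero    x≢y = ⊥-elim (x≢y refl)
sum-pair-≤ f zero    (suc y) x≢y = +-monoʳ-≤ (f zero) (sum-single-≤ (f ∘ suc) y)
sum-pair-≤ f (suc x) zero    x≢y =
  subst (_≤ sum f) (+-comm (f zero) (f (suc x))) (+-monoʳ-≤ (f zero) (sum-single-≤ (f ∘ suc) x))
sum-pair-≤ f (suc x) (suc y) x≢y =
  ≤-trans (sum-pair-≤ (f ∘ suc) x y (x≢y ∘ cong suc)) (m≤n+m _ (f zero))

∣∣≡card : ∀ {n} (D : Subset n) → ∣ D ∣ ≡ card (lookup D)
∣∣≡card []          = refl
∣∣≡card (true ∷ D)  = cong suc (∣∣≡card D)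
∣∣≡card (false ∷ D) = ∣∣≡card D

length-filter-tabulate : ∀ {n} {X : Set} {P : X → Set} (P? : ∀ x → Dec (P x)) (f : Fin n → X) →
  length (filter P? (listTabulate f)) ≡ sum (λ i → bit (does (P? (f i))))
length-filter-tabulate {zero}  P? f = refl
length-filter-tabulate {suc n} P? f with does (P? (f zero))
... | true  = cong suc (length-filter-tabulate P? (f ∘ suc))
... | false = length-filter-tabulate P? (f ∘ suc)

⌊≟⌋-refl : ∀ {n} (a : Fin n) → ⌊ a ≟ a ⌋ ≡ true
⌊≟⌋-refl a with a ≟ a
... | yes _   = refl
... | no a≢a = ⊥-elim (a≢a refl)

⌊≟⌋-≢ : ∀ {n} {a b : Fin n} → a ≢ b → ⌊ a ≟ b ⌋ ≡ false
⌊≟⌋-≢ {a = a} {b} a≢b with a ≟ b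
... | yes a≡b = ⊥-elim (a≢b a≡b)
... | no _    = refl

⌊≟⌋-injective : ∀ {m n} (f : Fin m → Fin n) → Injective _≡_ _≡_ f →
                ∀ a b → ⌊ f a ≟ f b ⌋ ≡ ⌊ a ≟ b ⌋
⌊≟⌋-injective f f-inj a b with f a ≟ f b | a ≟ b
... | yes _   | yes _   = refl
... | no _    | no _    = refl
... | yes fab | no a≢b  = ⊥-elim (a≢b (f-inj fab))
... | no fa≢b | yes a≡b = ⊥-elim (fa≢b (cong f a≡b))

incidence : ∀ {n} → Fin n × Fin n → Fin n → ℕ
incidence (a , b) v = bit (⌊ a ≟ v ⌋ ∨ ⌊ b ≟ v ⌋)

deg-∷ : ∀ {n} (e : Fin n × Fin n) E v → deg (e ∷ E) v ≡ incidence e v + deg E v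
deg-∷ (a , b) E v with ⌊ a ≟ v ⌋ ∨ ⌊ b ≟ v ⌋
... | true  = refl
... | false = refl

deg-++ : ∀ {n} (xs ys : Edges n) v → deg (xs ++ ys) v ≡ deg xs v + deg ys v
deg-++ []       ys v = refl
deg-++ (e ∷ xs) ys v = begin
  deg (e ∷ xs ++ ys) v                  ≡⟨ deg-∷ e (xs ++ ys) v ⟩
  incidence e v + deg (xs ++ ys) v      ≡⟨ cong (incidence e v +_) (deg-++ xs ys v) ⟩
  incidence e v + (deg xs v + deg ys v) ≡⟨ sym (+-assoc (incidence e v) _ _) ⟩
  incidence e v + deg xs v + deg ys v   ≡⟨ cong (_+ deg ys v) (sym (deg-∷ e xs v)) ⟩
  deg (e ∷ xs) v + deg ys v             ∎
  where open ≡-Reasoning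

deg-mapE : ∀ {m n} (f : Fin m → Fin n) → Injective _≡_ _≡_ f →
           ∀ E w → deg (mapE f E) (f w) ≡ deg E w
deg-mapE f f-inj []            w = refl
deg-mapE f f-inj ((a , b) ∷ E) w = begin
  deg (mapE f ((a , b) ∷ E)) (f w)               ≡⟨ deg-∷ (f a , f b) (mapE f E) (f w) ⟩
  incidence (f a , f b) (f w) + deg (mapE f E) (f w)
    ≡⟨ cong₂ (λ x y → bit (x ∨ y) + deg (mapE f E) (f w))
             (⌊≟⌋-injective f f-inj a w) (⌊≟⌋-injective f f-inj b w) ⟩
  incidence (a , b) w + deg (mapE f E) (f w)     ≡⟨ cong (incidence (a , b) w +_) (deg-mapE f f-inj E w) ⟩
  incidence (a , b) w + deg E w                  ≡⟨ sym (deg-∷ (a , b) E w) ⟩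
  deg ((a , b) ∷ E) w                            ∎
  where open ≡-Reasoning

deg-mapE-outside : ∀ {m n} (f : Fin m → Fin n) z → (∀ a → f a ≢ z) → ∀ E → deg (mapE f E) z ≡ 0
deg-mapE-outside f z outside []            = refl
deg-mapE-outside f z outside ((a , b) ∷ E) = begin
  deg (mapE f ((a , b) ∷ E)) z                   ≡⟨ deg-∷ (f a , f b) (mapE f E) z ⟩
  incidence (f a , f b) z + deg (mapE f E) z
    ≡⟨ cong₂ (λ x y → bit (x ∨ y) + deg (mapE f E) z) (⌊≟⌋-≢ (outside a)) (⌊≟⌋-≢ (outside b)) ⟩
  deg (mapE f E) z                               ≡⟨ deg-mapE-outside f z outside E ⟩
  0                                              ∎
  where open ≡-Reasoning

leafBit : ℕ → ℕ
leafBit d = bit (does (d ≟ℕ 1))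

leaves≡sum : ∀ {n} (E : Edges n) → leaves E ≡ sum (leafBit ∘ deg E)
leaves≡sum E = length-filter-tabulate (λ v → deg E v ≟ℕ 1) id

leafBit-bump : ∀ b d → 2 ≤ d → leafBit (bit b + d) ≡ leafBit d
leafBit-bump false d          _              = refl
leafBit-bump true  (suc (suc d)) _           = refl
leafBit-bump true  (suc zero) (s≤s ())

Adj-∷⁻ : ∀ {n} {p q : Fin n} {E x y} → Adj ((p , q) ∷ E) x y →
         ((x ≡ p × y ≡ q) ⊎ (x ≡ q × y ≡ p)) ⊎ Adj E x y
Adj-∷⁻ (inj₁ (here refl)) = inj₁ (inj₁ (refl , refl))
Adj-∷⁻ (inj₁ (there x∈E)) = inj₂ (inj₁ x∈E)
Adj-∷⁻ (inj₂ (here refl)) = inj₁ (inj₂ (refl , refl))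
Adj-∷⁻ (inj₂ (there x∈E)) = inj₂ (inj₂ x∈E)

Adj-∷ʳ : ∀ {n} {e : Fin n × Fin n} {E x y} → Adj E x y → Adj (e ∷ E) x y
Adj-∷ʳ (inj₁ x∈E) = inj₁ (there x∈E)
Adj-∷ʳ (inj₂ x∈E) = inj₂ (there x∈E)

Adj-++⁻ : ∀ {n} (xs : Edges n) {ys x y} → Adj (xs ++ ys) x y → Adj xs x y ⊎ Adj ys x y
Adj-++⁻ xs (inj₁ e∈) with ∈-++⁻ xs e∈
... | inj₁ e∈xs = inj₁ (inj₁ e∈xs)
... | inj₂ e∈ys = inj₂ (inj₁ e∈ys)
Adj-++⁻ xs (inj₂ e∈) with ∈-++⁻ xs e∈
... | inj₁ e∈xs = inj₁ (inj₂ e∈xs)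
... | inj₂ e∈ys = inj₂ (inj₂ e∈ys)

Adj-++ˡ : ∀ {n} {xs ys : Edges n} {x y} → Adj xs x y → Adj (xs ++ ys) x y
Adj-++ˡ (inj₁ e∈) = inj₁ (∈-++⁺ˡ e∈)
Adj-++ˡ (inj₂ e∈) = inj₂ (∈-++⁺ˡ e∈)

Adj-++ʳ : ∀ {n} (xs : Edges n) {ys x y} → Adj ys x y → Adj (xs ++ ys) x y
Adj-++ʳ xs (inj₁ e∈) = inj₁ (∈-++⁺ʳ xs e∈)
Adj-++ʳ xs (inj₂ e∈) = inj₂ (∈-++⁺ʳ xs e∈)

Adj-mapE⁺ : ∀ {m n} (f : Fin m → Fin n) {E a b} → Adj E a b → Adj (mapE f E) (f a) (f b)
Adj-mapE⁺ f (inj₁ e∈) = inj₁ (∈-map⁺ _ e∈)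
Adj-mapE⁺ f (inj₂ e∈) = inj₂ (∈-map⁺ _ e∈)

Adj-mapE⁻ : ∀ {m n} (f : Fin m → Fin n) {E x y} → Adj (mapE f E) x y →
            ∃[ a ] ∃[ b ] (x ≡ f a × y ≡ f b × Adj E a b)
Adj-mapE⁻ f (inj₁ e∈) with ∈-map⁻ _ e∈
... | (a , b) , ab∈ , refl = a , b , refl , refl , inj₁ ab∈
Adj-mapE⁻ f (inj₂ e∈) with ∈-map⁻ _ e∈
... | (a , b) , ab∈ , refl = b , a , refl , refl , inj₂ ab∈

data P5Edge : Fin 5 → Fin 5 → Set where
  e01 : P5Edge 0F 1F
  e10 : P5Edge 1F 0F
  e12 : P5Edge 1F 2F
  e21 : P5Edge 2F 1F
  e23 : P5Edge 2F 3F
  e32 : P5Edge 3F 2F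
  e34 : P5Edge 3F 4F
  e43 : P5Edge 4F 3F

3F≢1F : _≢_ {A = Fin 5} 3F 1F
3F≢1F ()

Adj-P5⁻ : ∀ {k j} → Adj P5 k j → P5Edge k j
Adj-P5⁻ (inj₁ (here refl))                         = e01
Adj-P5⁻ (inj₁ (there (here refl)))                 = e12
Adj-P5⁻ (inj₁ (there (there (here refl))))         = e23
Adj-P5⁻ (inj₁ (there (there (there (here refl))))) = e34
Adj-P5⁻ (inj₂ (here refl))                         = e10
Adj-P5⁻ (inj₂ (there (here refl)))                 = e21
Adj-P5⁻ (inj₂ (there (there (here refl))))         = e32
Adj-P5⁻ (inj₂ (there (there (there (here refl))))) = e43

Adj-P5⁺ : ∀ {k j} → P5Edge k j → Adj P5 k j
Adj-P5⁺ e01 = inj₁ (here refl)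
Adj-P5⁺ e12 = inj₁ (there (here refl))
Adj-P5⁺ e23 = inj₁ (there (there (here refl)))
Adj-P5⁺ e34 = inj₁ (there (there (there (here refl))))
Adj-P5⁺ e10 = inj₂ (here refl)
Adj-P5⁺ e21 = inj₂ (there (here refl))
Adj-P5⁺ e32 = inj₂ (there (there (here refl)))
Adj-P5⁺ e43 = inj₂ (there (there (there (here refl))))

last-or-inject₁ : ∀ {n} (w : Fin (suc n)) → w ≡ fromℕ n ⊎ ∃[ w' ] (w ≡ inject₁ w')
last-or-inject₁ {zero}  zero    = inj₁ refl
last-or-inject₁ {suc n} zero    = inj₂ (zero , refl)
last-or-inject₁ {suc n} (suc w) with last-or-inject₁ w
... | inj₁ refl       = inj₁ refl
... | inj₂ (w' , refl) = inj₂ (suc w' , refl)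

inject₁≢last : ∀ {n} (a : Fin n) → inject₁ a ≢ fromℕ n
inject₁≢last a eq = fromℕ≢inject₁ (sym eq)

left-or-right : ∀ n {k} (w : Fin (n + k)) → (∃[ a ] (w ≡ a ↑ˡ k)) ⊎ (∃[ j ] (w ≡ n ↑ʳ j))
left-or-right n w with splitAt n w in eq
... | inj₁ a = inj₁ (a , sym (splitAt⁻¹-↑ˡ eq))
... | inj₂ j = inj₂ (j , sym (splitAt⁻¹-↑ʳ eq))

↑ˡ≢↑ʳ : ∀ {n k} (a : Fin n) (j : Fin k) → a ↑ˡ k ≢ n ↑ʳ j
↑ˡ≢↑ʳ {n} {k} a j eq = <⇒≢ (≤-trans (toℕ<n a) (m≤m+n n (toℕ j)))
  (trans (sym (toℕ-↑ˡ a k)) (trans (cong toℕ eq) (toℕ-↑ʳ n j)))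

O1L-old : ∀ {n} (S : Labeling n) w → O1L S (inject₁ w) ≡ S w
O1L-old {n} S w with toℕ (inject₁ w) <? n
... | yes p = cong S (toℕ-injective (trans (toℕ-fromℕ< p) (toℕ-inject₁ w)))
... | no ¬p = ⊥-elim (¬p (subst (_< n) (sym (toℕ-inject₁ w)) (toℕ<n w)))

O1L-new : ∀ {n} (S : Labeling n) → O1L S (fromℕ n) ≡ C
O1L-new {n} S with toℕ (fromℕ n) <? n
... | yes p = ⊥-elim (<-irrefl (toℕ-fromℕ n) p)
... | no _  = refl

O2L-old : ∀ {n} (S : Labeling n) w → O2L S (w ↑ˡ 5) ≡ S w
O2L-old {n} S w rewrite splitAt-↑ˡ n w 5 = refl

O2L-new : ∀ {n} (S : Labeling n) k → O2L S (n ↑ʳ k) ≡ P5lab k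
O2L-new {n} S k rewrite splitAt-↑ʳ n 5 k = refl

module OperationAdjacency {n} (E : Edges n) (v : Fin n) where

  O1-old⁻ : ∀ {a w} → Adj (O1E E v) (inject₁ a) w →
            (a ≡ v × w ≡ fromℕ n) ⊎ ∃[ w' ] (w ≡ inject₁ w' × Adj E a w')
  O1-old⁻ {a} adj with Adj-∷⁻ adj
  ... | inj₁ (inj₁ (a≡new , _))   = ⊥-elim (inject₁≢last a a≡new)
  ... | inj₁ (inj₂ (a≡v , w≡new)) = inj₁ (inject₁-injective a≡v , w≡new)
  ... | inj₂ old with Adj-mapE⁻ inject₁ old
  ... | _ , b , a≡ , refl , ab = inj₂ (b , refl , subst (λ z → Adj E z b) (sym (inject₁-injective a≡)) ab)

  O1-old⁺ : ∀ {a b} → Adj E a b → Adj (O1E E v) (inject₁ a) (inject₁ b)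
  O1-old⁺ ab = Adj-∷ʳ (Adj-mapE⁺ inject₁ ab)

  O1-link : Adj (O1E E v) (fromℕ n) (inject₁ v)
  O1-link = inj₁ (here refl)

  O2-old⁻ : ∀ {a w} → Adj (O2E E v) (a ↑ˡ 5) w →
            (a ≡ v × w ≡ n ↑ʳ 0F) ⊎ ∃[ w' ] (w ≡ w' ↑ˡ 5 × Adj E a w')
  O2-old⁻ {a} adj with Adj-∷⁻ adj
  ... | inj₁ (inj₁ (a≡new , _))   = ⊥-elim (↑ˡ≢↑ʳ a 0F a≡new)
  ... | inj₁ (inj₂ (a≡v , w≡new)) = inj₁ (↑ˡ-injective 5 a v a≡v , w≡new)
  ... | inj₂ rest with Adj-++⁻ (mapE (n ↑ʳ_) P5) rest
  ... | inj₁ inBlock with Adj-mapE⁻ (n ↑ʳ_) inBlock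
  ...   | k , _ , a≡ , _ = ⊥-elim (↑ˡ≢↑ʳ a k a≡)
  O2-old⁻ {a} adj | inj₂ rest | inj₂ old with Adj-mapE⁻ (_↑ˡ 5) old
  ... | a' , b , a≡ , refl , ab =
    inj₂ (b , refl , subst (λ z → Adj E z b) (sym (↑ˡ-injective 5 a a' a≡)) ab)

  O2-new⁻ : ∀ {k w} → Adj (O2E E v) (n ↑ʳ k) w →
            (k ≡ 0F × w ≡ v ↑ˡ 5) ⊎ ∃[ j ] (w ≡ n ↑ʳ j × P5Edge k j)
  O2-new⁻ {k} adj with Adj-∷⁻ adj
  ... | inj₁ (inj₁ (k≡0 , w≡v)) = inj₁ (↑ʳ-injective n k 0F k≡0 , w≡v)
  ... | inj₁ (inj₂ (k≡v , _))   = ⊥-elim (↑ˡ≢↑ʳ v k (sym k≡v))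
  ... | inj₂ rest with Adj-++⁻ (mapE (n ↑ʳ_) P5) rest
  ... | inj₁ inBlock with Adj-mapE⁻ (n ↑ʳ_) inBlock
  ...   | k' , j , k≡ , refl , kj =
    inj₂ (j , refl , Adj-P5⁻ (subst (λ z → Adj P5 z j) (sym (↑ʳ-injective n k k' k≡)) kj))
  O2-new⁻ {k} adj | inj₂ rest | inj₂ old with Adj-mapE⁻ (_↑ˡ 5) old
  ... | a' , _ , k≡ , _ = ⊥-elim (↑ˡ≢↑ʳ a' k (sym k≡))

  O2-old⁺ : ∀ {a b} → Adj E a b → Adj (O2E E v) (a ↑ˡ 5) (b ↑ˡ 5)
  O2-old⁺ ab = Adj-∷ʳ (Adj-++ʳ (mapE (n ↑ʳ_) P5) (Adj-mapE⁺ (_↑ˡ 5) ab))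

  O2-new⁺ : ∀ {k j} → P5Edge k j → Adj (O2E E v) (n ↑ʳ k) (n ↑ʳ j)
  O2-new⁺ kj = Adj-∷ʳ (Adj-++ˡ (Adj-mapE⁺ (n ↑ʳ_) (Adj-P5⁺ kj)))

-- O1 at a vertex of degree ≥ 2 adds exactly
-- one leaf; O2 at a leaf v turns v into an inner vertex and adds the new leaf n ↑ʳ 4F,
-- so the number of leaves is unchanged.

module OperationDegrees {n} (E : Edges n) (v : Fin n) where

  O1-deg-old : ∀ w → deg (O1E E v) (inject₁ w) ≡ bit ⌊ v ≟ w ⌋ + deg E w
  O1-deg-old w = begin
    deg (O1E E v) (inject₁ w)
      ≡⟨ deg-∷ (fromℕ n , inject₁ v) (mapE inject₁ E) (inject₁ w) ⟩
    incidence (fromℕ n , inject₁ v) (inject₁ w) + deg (mapE inject₁ E) (inject₁ w)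
      ≡⟨ cong₂ (λ x y → bit (x ∨ y) + deg (mapE inject₁ E) (inject₁ w))
               (⌊≟⌋-≢ (inject₁≢last w ∘ sym)) (⌊≟⌋-injective inject₁ inject₁-injective v w) ⟩
    bit ⌊ v ≟ w ⌋ + deg (mapE inject₁ E) (inject₁ w)
      ≡⟨ cong (bit ⌊ v ≟ w ⌋ +_) (deg-mapE inject₁ inject₁-injective E w) ⟩
    bit ⌊ v ≟ w ⌋ + deg E w ∎
    where open ≡-Reasoning

  O1-deg-new : deg (O1E E v) (fromℕ n) ≡ 1
  O1-deg-new = trans (deg-∷ (fromℕ n , inject₁ v) (mapE inject₁ E) (fromℕ n))
    (cong₂ (λ x y → bit (x ∨ ⌊ inject₁ v ≟ fromℕ n ⌋) + y)
           (⌊≟⌋-refl (fromℕ n)) (deg-mapE-outside inject₁ (fromℕ n) inject₁≢last E))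

  O1-leaves : 2 ≤ deg E v → leaves (O1E E v) ≡ suc (leaves E)
  O1-leaves 2≤dv = begin
    leaves (O1E E v)                                      ≡⟨ leaves≡sum (O1E E v) ⟩
    sum (leafBit ∘ deg (O1E E v))                         ≡⟨ sum-init-last (leafBit ∘ deg (O1E E v)) ⟩
    sum (leafBit ∘ deg (O1E E v) ∘ inject₁) + leafBit (deg (O1E E v) (fromℕ n))
      ≡⟨ cong₂ _+_ (sum-cong-≗ old) (cong leafBit O1-deg-new) ⟩
    sum (leafBit ∘ deg E) + 1                             ≡⟨ +-comm _ 1 ⟩
    suc (sum (leafBit ∘ deg E))                           ≡⟨ cong suc (sym (leaves≡sum E)) ⟩
    suc (leaves E)                                        ∎
    where
    open ≡-Reasoning
    old : ∀ w → leafBit (deg (O1E E v) (inject₁ w)) ≡ leafBit (deg E w)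
    old w rewrite O1-deg-old w with v ≟ w
    ... | no _     = refl
    ... | yes refl = leafBit-bump true (deg E v) 2≤dv

  private
    rest : Edges (n + 5)
    rest = mapE (n ↑ʳ_) P5 ++ mapE (_↑ˡ 5) E

  O2-deg-old : ∀ w → deg (O2E E v) (w ↑ˡ 5) ≡ bit ⌊ v ≟ w ⌋ + deg E w
  O2-deg-old w = begin
    deg (O2E E v) (w ↑ˡ 5)
      ≡⟨ deg-∷ (n ↑ʳ 0F , v ↑ˡ 5) rest (w ↑ˡ 5) ⟩
    incidence (n ↑ʳ 0F , v ↑ˡ 5) (w ↑ˡ 5) + deg rest (w ↑ˡ 5)
      ≡⟨ cong₂ (λ x y → bit (x ∨ y) + deg rest (w ↑ˡ 5))
               (⌊≟⌋-≢ (↑ˡ≢↑ʳ w 0F ∘ sym)) (⌊≟⌋-injective (_↑ˡ 5) (↑ˡ-injective 5 _ _) v w) ⟩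
    bit ⌊ v ≟ w ⌋ + deg rest (w ↑ˡ 5)
      ≡⟨ cong (bit ⌊ v ≟ w ⌋ +_) (deg-++ (mapE (n ↑ʳ_) P5) (mapE (_↑ˡ 5) E) (w ↑ˡ 5)) ⟩
    bit ⌊ v ≟ w ⌋ + (deg (mapE (n ↑ʳ_) P5) (w ↑ˡ 5) + deg (mapE (_↑ˡ 5) E) (w ↑ˡ 5))
      ≡⟨ cong (bit ⌊ v ≟ w ⌋ +_) (cong₂ _+_ (deg-mapE-outside (n ↑ʳ_) (w ↑ˡ 5) (λ j → ↑ˡ≢↑ʳ w j ∘ sym) P5)
                                            (deg-mapE (_↑ˡ 5) (↑ˡ-injective 5 _ _) E w)) ⟩
    bit ⌊ v ≟ w ⌋ + deg E w ∎
    where open ≡-Reasoning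

  O2-deg-new : ∀ k → deg (O2E E v) (n ↑ʳ k) ≡ bit ⌊ 0F ≟ k ⌋ + deg P5 k
  O2-deg-new k = begin
    deg (O2E E v) (n ↑ʳ k)
      ≡⟨ deg-∷ (n ↑ʳ 0F , v ↑ˡ 5) rest (n ↑ʳ k) ⟩
    incidence (n ↑ʳ 0F , v ↑ˡ 5) (n ↑ʳ k) + deg rest (n ↑ʳ k)
      ≡⟨ cong₂ (λ x y → bit (x ∨ y) + deg rest (n ↑ʳ k))
               (⌊≟⌋-injective (n ↑ʳ_) (↑ʳ-injective n _ _) 0F k) (⌊≟⌋-≢ (↑ˡ≢↑ʳ v k)) ⟩
    bit (⌊ 0F ≟ k ⌋ ∨ false) + deg rest (n ↑ʳ k)
      ≡⟨ cong₂ (λ x y → bit x + y) (∨-identityʳ ⌊ 0F ≟ k ⌋)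
               (deg-++ (mapE (n ↑ʳ_) P5) (mapE (_↑ˡ 5) E) (n ↑ʳ k)) ⟩
    bit ⌊ 0F ≟ k ⌋ + (deg (mapE (n ↑ʳ_) P5) (n ↑ʳ k) + deg (mapE (_↑ˡ 5) E) (n ↑ʳ k))
      ≡⟨ cong (bit ⌊ 0F ≟ k ⌋ +_) (cong₂ _+_ (deg-mapE (n ↑ʳ_) (↑ʳ-injective n _ _) P5 k)
                                              (deg-mapE-outside (_↑ˡ 5) (n ↑ʳ k) (λ a → ↑ˡ≢↑ʳ a k) E)) ⟩
    bit ⌊ 0F ≟ k ⌋ + (deg P5 k + 0)
      ≡⟨ cong (bit ⌊ 0F ≟ k ⌋ +_) (+-identityʳ (deg P5 k)) ⟩
    bit ⌊ 0F ≟ k ⌋ + deg P5 k ∎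
    where open ≡-Reasoning

  O2-leaves : deg E v ≡ 1 → leaves (O2E E v) ≡ leaves E
  O2-leaves dv≡1 = begin
    leaves (O2E E v)                                      ≡⟨ leaves≡sum (O2E E v) ⟩
    sum (leafBit ∘ deg (O2E E v))                         ≡⟨ sum-↑ n (leafBit ∘ deg (O2E E v)) ⟩
    sum old' + sum (leafBit ∘ deg (O2E E v) ∘ (n ↑ʳ_))    ≡⟨ cong (sum old' +_) (sum-cong-≗ new) ⟩
    sum old' + 1                                          ≡⟨ cong (sum old' +_) (sym (cong leafBit dv≡1)) ⟩
    sum old' + leafBit (deg E v)
      ≡⟨ sum-agree-except old' (leafBit ∘ deg E) v agree ⟩
    sum (leafBit ∘ deg E) + old' v                        ≡⟨ cong (λ d → sum (leafBit ∘ deg E) + leafBit d) at-v ⟩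
    sum (leafBit ∘ deg E) + 0                             ≡⟨ +-identityʳ _ ⟩
    sum (leafBit ∘ deg E)                                 ≡⟨ sym (leaves≡sum E) ⟩
    leaves E                                              ∎
    where
    open ≡-Reasoning
    old' : Fin n → ℕ
    old' w = leafBit (deg (O2E E v) (w ↑ˡ 5))
    new : ∀ k → leafBit (deg (O2E E v) (n ↑ʳ k)) ≡ leafBit (bit ⌊ 0F ≟ k ⌋ + deg P5 k)
    new k = cong leafBit (O2-deg-new k)
    at-v : deg (O2E E v) (v ↑ˡ 5) ≡ 2
    at-v = trans (O2-deg-old v) (cong₂ _+_ (cong bit (⌊≟⌋-refl v)) dv≡1)
    agree : ∀ w → w ≢ v → old' w ≡ leafBit (deg E w)
    agree w w≢v = cong leafBit (trans (O2-deg-old w) (cong (λ b → bit b + deg E w) (⌊≟⌋-≢ (w≢v ∘ sym))))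

isA : Status → Bool
isA A = true
isA B = false
isA C = false

isA→≡A : ∀ s → isA s ≡ true → s ≡ A
isA→≡A A _ = refl

A≢B : A ≢ B
A≢B ()

A≢C : A ≢ C
A≢C ()

C≢B : C ≢ B
C≢B ()

-- The A/B-domination condition on a vertex set χ, the part of semitotal domination that
-- the lower bound uses: every A-vertex is in χ or has a neighbour in χ, and every
-- B-vertex of χ has another vertex of χ adjacent to it or at distance 2 via an A-vertex.
record ABDominating {n} (E : Edges n) (S : Labeling n) (χ : Fin n → Bool) : Set where
  constructor abDominating
  field
    dominates-A : ∀ a → S a ≡ A → ∃[ w ] (χ w ≡ true × (w ≡ a ⊎ Adj E a w))
    partner-B   : ∀ b → S b ≡ B → χ b ≡ true → ∃[ w ] (χ w ≡ true × w ≢ b ×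
                    (Adj E b w ⊎ ∃[ x ] (S x ≡ A × Adj E b x × Adj E x w)))

-- The invariant of the family 𝒯, where `blocks` = m counts the P5-blocks of the
-- construction.  `order` and `count-A` give the numbers; `nonA-dom` and `A-partner` make
-- the A-vertices a semitotal dominating set; `B-nbr-A` turns semitotal domination into
-- A/B-domination; `A-nonleaf` is needed to count leaves after O1; `lower-bound` is the
-- minimality statement.
record Invariant (n : ℕ) (E : Edges n) (S : Labeling n) : Set where
  field
    blocks      : ℕ
    order       : n + 2 ≡ 5 * blocks + leaves E
    count-A     : card (isA ∘ S) ≡ 2 * blocks
    B-nbr-A     : ∀ b x → S b ≡ B → Adj E b x → S x ≡ A
    nonA-dom    : ∀ w → S w ≢ A → ∃[ u ] (S u ≡ A × Adj E w u)
    A-partner   : ∀ a → S a ≡ A → ∃[ a' ] ∃[ x ] (S a' ≡ A × a' ≢ a × Adj E a x × Adj E x a')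
    A-nonleaf   : ∀ a → S a ≡ A → 2 ≤ deg E a
    lower-bound : ∀ χ → ABDominating E S χ → 2 * blocks ≤ card χ

-- Any A/B-dominating
-- set contains at least two block vertices: it dominates 1 and 3, and if one vertex
-- (necessarily 2) does both, then 2 needs a partner, which again lies in the block.

module P5Block {N} (E : Edges N) (S : Labeling N) (ι : Fin 5 → Fin N)
  (s1 : S (ι 1F) ≡ A) (s2 : S (ι 2F) ≡ B) (s3 : S (ι 3F) ≡ A)
  (nbrs1 : ∀ w → Adj E (ι 1F) w → ∃[ j ] (w ≡ ι j × P5Edge 1F j))
  (nbrs2 : ∀ w → Adj E (ι 2F) w → ∃[ j ] (w ≡ ι j × P5Edge 2F j))
  (nbrs3 : ∀ w → Adj E (ι 3F) w → ∃[ j ] (w ≡ ι j × P5Edge 3F j))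
  (χ : Fin N → Bool) (dom : ABDominating E S χ) where

  open ABDominating dom

  N[1] N[3] : Fin 5 → Set
  N[1] j = j ≡ 1F ⊎ P5Edge 1F j
  N[3] j = j ≡ 3F ⊎ P5Edge 3F j

  N[1]∩N[3] : ∀ j → N[1] j → N[3] j → j ≡ 2F
  N[1]∩N[3] .1F (inj₁ refl) (inj₁ ())
  N[1]∩N[3] .1F (inj₁ refl) (inj₂ ())
  N[1]∩N[3] .0F (inj₂ e10)  (inj₁ ())
  N[1]∩N[3] .0F (inj₂ e10)  (inj₂ ())
  N[1]∩N[3] .2F (inj₂ e12)  _ = refl

  P5Edge-2 : ∀ {j} → P5Edge 2F j → j ≢ 2F
  P5Edge-2 e21 ()
  P5Edge-2 e23 ()

  dominator1 : ∃[ j ] (χ (ι j) ≡ true × N[1] j)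
  dominator1 with dominates-A (ι 1F) s1
  ... | w , χw , inj₁ refl = 1F , χw , inj₁ refl
  ... | w , χw , inj₂ adj with nbrs1 w adj
  ...   | j , refl , 1j = j , χw , inj₂ 1j

  dominator3 : ∃[ j ] (χ (ι j) ≡ true × N[3] j)
  dominator3 with dominates-A (ι 3F) s3
  ... | w , χw , inj₁ refl = 3F , χw , inj₁ refl
  ... | w , χw , inj₂ adj with nbrs3 w adj
  ...   | j , refl , 3j = j , χw , inj₂ 3j

  partner2 : χ (ι 2F) ≡ true → ∃[ j ] (χ (ι j) ≡ true × j ≢ 2F)
  partner2 χ2 with partner-B (ι 2F) s2 χ2
  ... | w , χw , w≢2 , inj₁ adj with nbrs2 w adj
  ...   | j , refl , 2j = j , χw , P5Edge-2 2j
  partner2 χ2 | w , χw , w≢2 , inj₂ (x , _ , 2x , xw) with nbrs2 x 2x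
  ... | .1F , refl , e21 with nbrs1 w xw
  ...   | j , refl , _ = j , χw , w≢2 ∘ cong ι
  partner2 χ2 | w , χw , w≢2 , inj₂ (x , _ , 2x , xw) | .3F , refl , e23 with nbrs3 w xw
  ...   | j , refl , _ = j , χw , w≢2 ∘ cong ι

  two-members : ∃[ j ] ∃[ k ] (χ (ι j) ≡ true × χ (ι k) ≡ true × j ≢ k)
  two-members with dominator1 | dominator3
  ... | j1 , χj1 , r1 | j3 , χj3 , r3 with j1 ≟ j3
  ... | no j1≢j3 = j1 , j3 , χj1 , χj3 , j1≢j3
  ... | yes refl with N[1]∩N[3] j1 r1 r3
  ...   | refl with partner2 χj1
  ...     | j , χj , j≢2 = j , 2F , χj , χj1 , j≢2

  block-card : 2 ≤ card (χ ∘ ι)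
  block-card with two-members
  ... | j , k , χj , χk , j≢k = ≤-trans (≤-reflexive (cong₂ (λ x y → bit x + bit y) (sym χj) (sym χk)))
                                        (sum-pair-≤ (bit ∘ χ ∘ ι) j k j≢k)

base-invariant : Invariant 5 P5 P5lab
base-invariant = record
  { blocks = 1 ; order = refl ; count-A = refl ; B-nbr-A = B-nbr-A ; nonA-dom = nonA-dom
  ; A-partner = A-partner ; A-nonleaf = A-nonleaf ; lower-bound = lower-bound }
  where
  B-nbr-A : ∀ b x → P5lab b ≡ B → Adj P5 b x → P5lab x ≡ A
  B-nbr-A b x sb adj with Adj-P5⁻ adj
  B-nbr-A .2F .1F _  _ | e21 = refl
  B-nbr-A .2F .3F _  _ | e23 = refl
  B-nbr-A .0F _   () _ | e01
  B-nbr-A .1F _   () _ | e10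
  B-nbr-A .1F _   () _ | e12
  B-nbr-A .3F _   () _ | e32
  B-nbr-A .3F _   () _ | e34
  B-nbr-A .4F _   () _ | e43
  nonA-dom : ∀ w → P5lab w ≢ A → ∃[ u ] (P5lab u ≡ A × Adj P5 w u)
  nonA-dom 0F _   = 1F , refl , Adj-P5⁺ e01
  nonA-dom 1F ¬A  = ⊥-elim (¬A refl)
  nonA-dom 2F _   = 1F , refl , Adj-P5⁺ e21
  nonA-dom 3F ¬A  = ⊥-elim (¬A refl)
  nonA-dom 4F _   = 3F , refl , Adj-P5⁺ e43
  A-partner : ∀ a → P5lab a ≡ A → ∃[ a' ] ∃[ x ] (P5lab a' ≡ A × a' ≢ a × Adj P5 a x × Adj P5 x a')
  A-partner 1F _ = 3F , 2F , refl , (λ ()) , Adj-P5⁺ e12 , Adj-P5⁺ e23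
  A-partner 3F _ = 1F , 2F , refl , (λ ()) , Adj-P5⁺ e32 , Adj-P5⁺ e21
  A-partner 0F ()
  A-partner 2F ()
  A-partner 4F ()
  A-nonleaf : ∀ a → P5lab a ≡ A → 2 ≤ deg P5 a
  A-nonleaf 1F _ = s≤s (s≤s z≤n)
  A-nonleaf 3F _ = s≤s (s≤s z≤n)
  A-nonleaf 0F ()
  A-nonleaf 2F ()
  A-nonleaf 4F ()
  nbrs : ∀ k w → Adj P5 k w → ∃[ j ] (w ≡ j × P5Edge k j)
  nbrs k w adj = w , refl , Adj-P5⁻ adj
  lower-bound : ∀ χ → ABDominating P5 P5lab χ → 2 * 1 ≤ card χ
  lower-bound χ dom = P5Block.block-card P5 P5lab id refl refl refl (nbrs 1F) (nbrs 2F) (nbrs 3F) χ dom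

-- For the lower
-- bound, an A/B-dominating set χ of the new tree is folded back onto the old tree by
-- moving the new leaf L into its support vertex v; this does not increase the size.

module O1-Preserves {n} {E : Edges n} {S : Labeling n} (I : Invariant n E S)
                    (v : Fin n) (sv : S v ≡ A) where
  open Invariant I
  open OperationAdjacency E v
  open OperationDegrees E v

  private
    E' = O1E E v
    S' = O1L S
    L  = fromℕ n

  count-A' : card (isA ∘ S') ≡ 2 * blocks
  count-A' = begin
    card (isA ∘ S')                                        ≡⟨ sum-init-last (bit ∘ isA ∘ S') ⟩
    card (isA ∘ S' ∘ inject₁) + bit (isA (S' L))           ≡⟨ cong₂ _+_ (sum-cong-≗ (cong (bit ∘ isA) ∘ O1L-old S))
                                                                        (cong (bit ∘ isA) (O1L-new S)) ⟩
    card (isA ∘ S) + 0                                     ≡⟨ +-identityʳ _ ⟩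
    card (isA ∘ S)                                         ≡⟨ count-A ⟩
    2 * blocks                                             ∎
    where open ≡-Reasoning

  B-nbr-A' : ∀ b x → S' b ≡ B → Adj E' b x → S' x ≡ A
  B-nbr-A' b x sb adj with last-or-inject₁ b
  ... | inj₁ refl = ⊥-elim (C≢B (sym (O1L-new S) ∙ sb))
  ... | inj₂ (b₀ , refl) with O1-old⁻ adj
  ...   | inj₁ (refl , _)        = ⊥-elim (A≢B (sym sv ∙ sym (O1L-old S b₀) ∙ sb))
  ...   | inj₂ (x₀ , refl , adj₀) = O1L-old S x₀ ∙ B-nbr-A b₀ x₀ (sym (O1L-old S b₀) ∙ sb) adj₀

  nonA-dom' : ∀ w → S' w ≢ A → ∃[ u ] (S' u ≡ A × Adj E' w u)
  nonA-dom' w ¬A with last-or-inject₁ w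
  ... | inj₁ refl = inject₁ v , O1L-old S v ∙ sv , O1-link
  ... | inj₂ (w₀ , refl) with nonA-dom w₀ (¬A ∘ (O1L-old S w₀ ∙_))
  ...   | u , su , adj = inject₁ u , O1L-old S u ∙ su , O1-old⁺ adj

  A-partner' : ∀ a → S' a ≡ A → ∃[ a' ] ∃[ x ] (S' a' ≡ A × a' ≢ a × Adj E' a x × Adj E' x a')
  A-partner' a sa with last-or-inject₁ a
  ... | inj₁ refl = ⊥-elim (A≢C (sym sa ∙ O1L-new S))
  ... | inj₂ (a₀ , refl) with A-partner a₀ (sym (O1L-old S a₀) ∙ sa)
  ...   | a' , x , sa' , a'≢a₀ , ax , xa' =
    inject₁ a' , inject₁ x , O1L-old S a' ∙ sa' , a'≢a₀ ∘ inject₁-injective , O1-old⁺ ax , O1-old⁺ xa'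

  A-nonleaf' : ∀ a → S' a ≡ A → 2 ≤ deg E' a
  A-nonleaf' a sa with last-or-inject₁ a
  ... | inj₁ refl = ⊥-elim (A≢C (sym sa ∙ O1L-new S))
  ... | inj₂ (a₀ , refl) rewrite O1-deg-old a₀ =
    ≤-trans (A-nonleaf a₀ (sym (O1L-old S a₀) ∙ sa)) (m≤n+m _ _)

  fold : (Fin (suc n) → Bool) → Fin n → Bool
  fold χ i = if ⌊ i ≟ v ⌋ then χ (inject₁ v) ∨ χ L else χ (inject₁ i)

  fold-v : ∀ χ → fold χ v ≡ χ (inject₁ v) ∨ χ L
  fold-v χ rewrite ⌊≟⌋-refl v = refl

  fold-other : ∀ χ i → i ≢ v → fold χ i ≡ χ (inject₁ i)
  fold-other χ i i≢v rewrite ⌊≟⌋-≢ i≢v = refl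

  fold-keeps : ∀ χ i → χ (inject₁ i) ≡ true → fold χ i ≡ true
  fold-keeps χ i χi with i ≟ v
  ... | yes refl rewrite χi = refl
  ... | no _     = χi

  fold-leaf : ∀ χ → χ L ≡ true → fold χ v ≡ true
  fold-leaf χ χL rewrite fold-v χ | χL = ∨-zeroʳ _

  card-fold : ∀ χ → card (fold χ) ≤ card χ
  card-fold χ = +-cancelʳ-≤ (g v) _ _ (begin
    card (fold χ) + g v                      ≡⟨ sum-agree-except (bit ∘ fold χ) g v agree ⟩
    sum g + bit (fold χ v)                   ≡⟨ cong (λ b → sum g + bit b) (fold-v χ) ⟩
    sum g + bit (χ (inject₁ v) ∨ χ L)        ≤⟨ +-monoʳ-≤ (sum g) (bit-∨ (χ (inject₁ v)) (χ L)) ⟩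
    sum g + (g v + bit (χ L))                ≡⟨ cong (sum g +_) (+-comm (g v) _) ⟩
    sum g + (bit (χ L) + g v)                ≡⟨ sym (+-assoc (sum g) _ _) ⟩
    sum g + bit (χ L) + g v                  ≡⟨ cong (_+ g v) (sym (sum-init-last (bit ∘ χ))) ⟩
    card χ + g v                             ∎)
    where
    open ≤-Reasoning
    g : Fin n → ℕ
    g = bit ∘ χ ∘ inject₁
    agree : ∀ i → i ≢ v → bit (fold χ i) ≡ g i
    agree i i≢v = cong bit (fold-other χ i i≢v)

  fold-dominating : ∀ χ → ABDominating E' S' χ → ABDominating E S (fold χ)
  fold-dominating χ dom = abDominating dominates-A partner-B
    where
    open ABDominating dom renaming (dominates-A to dominates-A'; partner-B to partner-B')
    B≢v : ∀ {b} → S b ≡ B → b ≢ v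
    B≢v sb refl = A≢B (sym sv ∙ sb)
    dominates-A : ∀ a → S a ≡ A → ∃[ w ] (fold χ w ≡ true × (w ≡ a ⊎ Adj E a w))
    dominates-A a sa with dominates-A' (inject₁ a) (O1L-old S a ∙ sa)
    ... | w , χw , inj₁ refl = a , fold-keeps χ a χw , inj₁ refl
    ... | w , χw , inj₂ adj with O1-old⁻ adj
    ...   | inj₁ (refl , refl)       = a , fold-leaf χ χw , inj₁ refl
    ...   | inj₂ (w₀ , refl , adj₀) = w₀ , fold-keeps χ w₀ χw , inj₂ adj₀
    partner-B : ∀ b → S b ≡ B → fold χ b ≡ true → ∃[ w ] (fold χ w ≡ true × w ≢ b ×
                  (Adj E b w ⊎ ∃[ x ] (S x ≡ A × Adj E b x × Adj E x w)))
    partner-B b sb χb with partner-B' (inject₁ b) (O1L-old S b ∙ sb)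
                                      (sym (fold-other χ b (B≢v sb)) ∙ χb)
    ... | w , χw , w≢b , inj₁ adj with O1-old⁻ adj
    ...   | inj₁ (refl , _)         = ⊥-elim (B≢v sb refl)
    ...   | inj₂ (w₀ , refl , adj₀) = w₀ , fold-keeps χ w₀ χw , w≢b ∘ cong inject₁ , inj₁ adj₀
    partner-B b sb χb | w , χw , w≢b , inj₂ (x , sx , bx , xw) with O1-old⁻ bx
    ... | inj₁ (refl , _)        = ⊥-elim (B≢v sb refl)
    ... | inj₂ (x₀ , refl , bx₀) with O1-old⁻ xw
    ...   | inj₁ (refl , refl)       = x₀ , fold-leaf χ χw , B≢v sb ∘ sym , inj₁ bx₀
    ...   | inj₂ (w₀ , refl , xw₀)  =
      w₀ , fold-keeps χ w₀ χw , w≢b ∘ cong inject₁ , inj₂ (x₀ , sym (O1L-old S x₀) ∙ sx , bx₀ , xw₀)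

  invariant : Invariant (suc n) E' S'
  invariant = record
    { blocks = blocks
    ; order = trans (cong suc order) (trans (sym (+-suc (5 * blocks) (leaves E)))
                    (cong (5 * blocks +_) (sym (O1-leaves (A-nonleaf v sv)))))
    ; count-A = count-A' ; B-nbr-A = B-nbr-A' ; nonA-dom = nonA-dom' ; A-partner = A-partner'
    ; A-nonleaf = A-nonleaf'
    ; lower-bound = λ χ dom → ≤-trans (lower-bound (fold χ) (fold-dominating χ dom)) (card-fold χ) }

-- For the lower bound, an
-- A/B-dominating set of the new tree restricts to one of the old tree (the attachment
-- vertex v has status C, so no A/B-condition on the old part uses the new block), and it
-- meets the new block, a P5Block, in at least two vertices.

module O2-Preserves {n} {E : Edges n} {S : Labeling n} (I : Invariant n E S)
                    (v : Fin n) (sv : S v ≡ C) (dv : deg E v ≡ 1) where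
  open Invariant I
  open OperationAdjacency E v
  open OperationDegrees E v

  private
    E' = O2E E v
    S' = O2L S
    new : Fin 5 → Fin (n + 5)
    new k = n ↑ʳ k

  order' : n + 5 + 2 ≡ 5 * suc blocks + leaves E'
  order' = begin
    n + 5 + 2                        ≡⟨ +-assoc n 5 2 ⟩
    n + (5 + 2)                      ≡⟨ cong (n +_) (+-comm 5 2) ⟩
    n + (2 + 5)                      ≡⟨ sym (+-assoc n 2 5) ⟩
    n + 2 + 5                        ≡⟨ cong (_+ 5) order ⟩
    5 * blocks + leaves E + 5        ≡⟨ +-comm _ 5 ⟩
    5 + (5 * blocks + leaves E)      ≡⟨ sym (+-assoc 5 (5 * blocks) (leaves E)) ⟩
    5 + 5 * blocks + leaves E        ≡⟨ cong₂ _+_ (sym (*-suc 5 blocks)) (sym (O2-leaves dv)) ⟩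
    5 * suc blocks + leaves E'       ∎
    where open ≡-Reasoning

  count-A' : card (isA ∘ S') ≡ 2 * suc blocks
  count-A' = begin
    card (isA ∘ S')                                          ≡⟨ sum-↑ n (bit ∘ isA ∘ S') ⟩
    card (isA ∘ S' ∘ (_↑ˡ 5)) + card (isA ∘ S' ∘ new)        ≡⟨ cong₂ _+_ (sum-cong-≗ (cong (bit ∘ isA) ∘ O2L-old S))
                                                                          (sum-cong-≗ (cong (bit ∘ isA) ∘ O2L-new S)) ⟩
    card (isA ∘ S) + 2                                       ≡⟨ cong (_+ 2) count-A ⟩
    2 * blocks + 2                                           ≡⟨ +-comm (2 * blocks) 2 ⟩
    2 + 2 * blocks                                           ≡⟨ sym (*-suc 2 blocks) ⟩
    2 * suc blocks                                           ∎
    where open ≡-Reasoning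

  B-nbr-A' : ∀ b x → S' b ≡ B → Adj E' b x → S' x ≡ A
  B-nbr-A' b x sb adj with left-or-right n b
  ... | inj₁ (b₀ , refl) with O2-old⁻ adj
  ...   | inj₁ (refl , _)        = ⊥-elim (C≢B (sym sv ∙ sym (O2L-old S b₀) ∙ sb))
  ...   | inj₂ (x₀ , refl , adj₀) = O2L-old S x₀ ∙ B-nbr-A b₀ x₀ (sym (O2L-old S b₀) ∙ sb) adj₀
  B-nbr-A' b x sb adj | inj₂ (k , refl) = in-block k (sym (O2L-new S k) ∙ sb) (O2-new⁻ adj)
    where
    in-block : ∀ k → P5lab k ≡ B → (k ≡ 0F × x ≡ v ↑ˡ 5) ⊎ ∃[ j ] (x ≡ new j × P5Edge k j) → S' x ≡ A
    in-block 2F _ (inj₁ (() , _))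
    in-block 2F _ (inj₂ (.1F , refl , e21)) = O2L-new S 1F
    in-block 2F _ (inj₂ (.3F , refl , e23)) = O2L-new S 3F
    in-block 0F () _
    in-block 1F () _
    in-block 3F () _
    in-block 4F () _

  nonA-dom' : ∀ w → S' w ≢ A → ∃[ u ] (S' u ≡ A × Adj E' w u)
  nonA-dom' w ¬A with left-or-right n w
  ... | inj₁ (w₀ , refl) with nonA-dom w₀ (¬A ∘ (O2L-old S w₀ ∙_))
  ...   | u , su , adj = u ↑ˡ 5 , O2L-old S u ∙ su , O2-old⁺ adj
  nonA-dom' w ¬A | inj₂ (k , refl) = in-block k (¬A ∘ (O2L-new S k ∙_))
    where
    in-block : ∀ k → P5lab k ≢ A → ∃[ u ] (S' u ≡ A × Adj E' (new k) u)
    in-block 0F _  = new 1F , O2L-new S 1F , O2-new⁺ e01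
    in-block 2F _  = new 1F , O2L-new S 1F , O2-new⁺ e21
    in-block 4F _  = new 3F , O2L-new S 3F , O2-new⁺ e43
    in-block 1F ¬A = ⊥-elim (¬A refl)
    in-block 3F ¬A = ⊥-elim (¬A refl)

  A-partner' : ∀ a → S' a ≡ A → ∃[ a' ] ∃[ x ] (S' a' ≡ A × a' ≢ a × Adj E' a x × Adj E' x a')
  A-partner' a sa with left-or-right n a
  ... | inj₁ (a₀ , refl) with A-partner a₀ (sym (O2L-old S a₀) ∙ sa)
  ...   | a' , x , sa' , a'≢a₀ , ax , xa' =
    a' ↑ˡ 5 , x ↑ˡ 5 , O2L-old S a' ∙ sa' , a'≢a₀ ∘ ↑ˡ-injective 5 _ _ , O2-old⁺ ax , O2-old⁺ xa'
  A-partner' a sa | inj₂ (k , refl) = in-block k (sym (O2L-new S k) ∙ sa)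
    where
    in-block : ∀ k → P5lab k ≡ A → ∃[ a' ] ∃[ x ] (S' a' ≡ A × a' ≢ new k × Adj E' (new k) x × Adj E' x a')
    in-block 1F _ = new 3F , new 2F , O2L-new S 3F , (λ eq → 3F≢1F (↑ʳ-injective n 3F 1F eq)) ,
                    O2-new⁺ e12 , O2-new⁺ e23
    in-block 3F _ = new 1F , new 2F , O2L-new S 1F , (λ eq → 3F≢1F (sym (↑ʳ-injective n 1F 3F eq))) ,
                    O2-new⁺ e32 , O2-new⁺ e21
    in-block 0F ()
    in-block 2F ()
    in-block 4F ()

  A-nonleaf' : ∀ a → S' a ≡ A → 2 ≤ deg E' a
  A-nonleaf' a sa with left-or-right n a
  ... | inj₁ (a₀ , refl) rewrite O2-deg-old a₀ = ≤-trans (A-nonleaf a₀ (sym (O2L-old S a₀) ∙ sa)) (m≤n+m _ _)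
  ... | inj₂ (k , refl) rewrite O2-deg-new k = in-block k (sym (O2L-new S k) ∙ sa)
    where
    in-block : ∀ k → P5lab k ≡ A → 2 ≤ bit ⌊ 0F ≟ k ⌋ + deg P5 k
    in-block 1F _ = s≤s (s≤s z≤n)
    in-block 3F _ = s≤s (s≤s z≤n)
    in-block 0F ()
    in-block 2F ()
    in-block 4F ()

  restrict-dominating : ∀ χ → ABDominating E' S' χ → ABDominating E S (χ ∘ (_↑ˡ 5))
  restrict-dominating χ dom = abDominating dominates-A partner-B
    where
    open ABDominating dom renaming (dominates-A to dominates-A'; partner-B to partner-B')
    dominates-A : ∀ a → S a ≡ A → ∃[ w ] (χ (w ↑ˡ 5) ≡ true × (w ≡ a ⊎ Adj E a w))
    dominates-A a sa with dominates-A' (a ↑ˡ 5) (O2L-old S a ∙ sa)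
    ... | w , χw , inj₁ refl = a , χw , inj₁ refl
    ... | w , χw , inj₂ adj with O2-old⁻ adj
    ...   | inj₁ (refl , _)         = ⊥-elim (A≢C (sym sa ∙ sv))
    ...   | inj₂ (w₀ , refl , adj₀) = w₀ , χw , inj₂ adj₀
    partner-B : ∀ b → S b ≡ B → χ (b ↑ˡ 5) ≡ true → ∃[ w ] (χ (w ↑ˡ 5) ≡ true × w ≢ b ×
                  (Adj E b w ⊎ ∃[ x ] (S x ≡ A × Adj E b x × Adj E x w)))
    partner-B b sb χb with partner-B' (b ↑ˡ 5) (O2L-old S b ∙ sb) χb
    ... | w , χw , w≢b , inj₁ adj with O2-old⁻ adj
    ...   | inj₁ (refl , _)         = ⊥-elim (C≢B (sym sv ∙ sb))
    ...   | inj₂ (w₀ , refl , adj₀) = w₀ , χw , w≢b ∘ cong (_↑ˡ 5) , inj₁ adj₀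
    partner-B b sb χb | w , χw , w≢b , inj₂ (x , sx , bx , xw) with O2-old⁻ bx
    ... | inj₁ (refl , _)        = ⊥-elim (C≢B (sym sv ∙ sb))
    ... | inj₂ (x₀ , refl , bx₀) with O2-old⁻ xw
    ...   | inj₁ (refl , _)        = ⊥-elim (A≢C (sym sx ∙ O2L-old S x₀ ∙ sv))
    ...   | inj₂ (w₀ , refl , xw₀) =
      w₀ , χw , w≢b ∘ cong (_↑ˡ 5) , inj₂ (x₀ , sym (O2L-old S x₀) ∙ sx , bx₀ , xw₀)

  inner-nbrs : ∀ k → k ≢ 0F → ∀ w → Adj E' (new k) w → ∃[ j ] (w ≡ new j × P5Edge k j)
  inner-nbrs k k≢0 w adj with O2-new⁻ adj
  ... | inj₁ (k≡0 , _) = ⊥-elim (k≢0 k≡0)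
  ... | inj₂ in-block  = in-block

  lower-bound' : ∀ χ → ABDominating E' S' χ → 2 * suc blocks ≤ card χ
  lower-bound' χ dom = begin
    2 * suc blocks                               ≡⟨ *-suc 2 blocks ⟩
    2 + 2 * blocks                               ≤⟨ +-mono-≤ block (lower-bound (χ ∘ (_↑ˡ 5)) (restrict-dominating χ dom)) ⟩
    card (χ ∘ new) + card (χ ∘ (_↑ˡ 5))          ≡⟨ +-comm (card (χ ∘ new)) _ ⟩
    card (χ ∘ (_↑ˡ 5)) + card (χ ∘ new)          ≡⟨ sym (sum-↑ n (bit ∘ χ)) ⟩
    card χ                                       ∎
    where
    open ≤-Reasoning
    block : 2 ≤ card (χ ∘ new)
    block = P5Block.block-card E' S' new (O2L-new S 1F) (O2L-new S 2F) (O2L-new S 3F)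
              (inner-nbrs 1F (λ ())) (inner-nbrs 2F (λ ())) (inner-nbrs 3F (λ ())) χ dom

  invariant : Invariant (n + 5) E' S'
  invariant = record
    { blocks = suc blocks ; order = order' ; count-A = count-A' ; B-nbr-A = B-nbr-A'
    ; nonA-dom = nonA-dom' ; A-partner = A-partner' ; A-nonleaf = A-nonleaf'
    ; lower-bound = lower-bound' }

module Iso-Preserves {n} {E : Edges n} {S : Labeling n} (I : Invariant n E S)
                     (σ : Permutation n n) where
  open Invariant I

  private
    E' = permE σ E
    S' = permL σ S
    to : Fin n → Fin n
    to i = σ ⟨$⟩ʳ i
    from : Fin n → Fin n
    from i = σ ⟨$⟩ˡ i
    from-to : ∀ i → from (to i) ≡ i
    from-to i = inverseˡ σ
    to-from : ∀ i → to (from i) ≡ i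
    to-from i = inverseʳ σ
    to-injective : Injective _≡_ _≡_ to
    to-injective {a} {b} eq = sym (from-to a) ∙ cong from eq ∙ from-to b

  Adj-to : ∀ {a b} → Adj E a b → Adj E' (to a) (to b)
  Adj-to = Adj-mapE⁺ to

  Adj-from : ∀ {x y} → Adj E' x y → Adj E (from x) (from y)
  Adj-from adj with Adj-mapE⁻ to adj
  ... | a , b , refl , refl , ab = subst₂ (Adj E) (sym (from-to a)) (sym (from-to b)) ab

  Adj-from-to : ∀ {x b} → Adj E (from x) b → Adj E' x (to b)
  Adj-from-to {x} adj = subst (λ z → Adj E' z _) (to-from x) (Adj-to adj)

  S'-to : ∀ i → S' (to i) ≡ S i
  S'-to i = cong S (from-to i)

  deg-to : ∀ i → deg E' (to i) ≡ deg E i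
  deg-to = deg-mapE to to-injective E

  card-to : ∀ χ → card χ ≡ card (χ ∘ to)
  card-to χ = sum-permute (bit ∘ χ) σ

  leaves' : leaves E' ≡ leaves E
  leaves' = begin
    leaves E'                      ≡⟨ leaves≡sum E' ⟩
    sum (leafBit ∘ deg E')         ≡⟨ sum-permute (leafBit ∘ deg E') σ ⟩
    sum (leafBit ∘ deg E' ∘ to)    ≡⟨ sum-cong-≗ (cong leafBit ∘ deg-to) ⟩
    sum (leafBit ∘ deg E)          ≡⟨ sym (leaves≡sum E) ⟩
    leaves E                       ∎
    where open ≡-Reasoning

  count-A' : card (isA ∘ S') ≡ 2 * blocks
  count-A' = card-to (isA ∘ S') ∙ sum-cong-≗ (cong (bit ∘ isA) ∘ S'-to) ∙ count-A

  nonA-dom' : ∀ w → S' w ≢ A → ∃[ u ] (S' u ≡ A × Adj E' w u)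
  nonA-dom' w ¬A with nonA-dom (from w) ¬A
  ... | u , su , adj = to u , S'-to u ∙ su , Adj-from-to adj

  A-partner' : ∀ a → S' a ≡ A → ∃[ a' ] ∃[ x ] (S' a' ≡ A × a' ≢ a × Adj E' a x × Adj E' x a')
  A-partner' a sa with A-partner (from a) sa
  ... | a' , x , sa' , a'≢a , ax , xa' =
    to a' , to x , S'-to a' ∙ sa' , (λ eq → a'≢a (sym (from-to a') ∙ cong from eq)) , Adj-from-to ax , Adj-to xa'

  A-nonleaf' : ∀ a → S' a ≡ A → 2 ≤ deg E' a
  A-nonleaf' a sa = subst (λ z → 2 ≤ deg E' z) (to-from a) (subst (2 ≤_) (sym (deg-to (from a))) (A-nonleaf (from a) sa))

  pullback-dominating : ∀ χ → ABDominating E' S' χ → ABDominating E S (χ ∘ to)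
  pullback-dominating χ dom = abDominating dominates-A partner-B
    where
    open ABDominating dom renaming (dominates-A to dominates-A'; partner-B to partner-B')
    χ-from : ∀ w → χ w ≡ true → χ (to (from w)) ≡ true
    χ-from w χw = cong χ (to-from w) ∙ χw
    from-to-≢ : ∀ {w b} → w ≢ to b → from w ≢ b
    from-to-≢ {w} w≢ eq = w≢ (sym (to-from w) ∙ cong to eq)
    dominates-A : ∀ a → S a ≡ A → ∃[ w ] (χ (to w) ≡ true × (w ≡ a ⊎ Adj E a w))
    dominates-A a sa with dominates-A' (to a) (S'-to a ∙ sa)
    ... | w , χw , inj₁ refl = from w , χ-from w χw , inj₁ (from-to a)
    ... | w , χw , inj₂ adj  = from w , χ-from w χw , inj₂ (subst (λ z → Adj E z (from w)) (from-to a) (Adj-from adj))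
    partner-B : ∀ b → S b ≡ B → χ (to b) ≡ true → ∃[ w ] (χ (to w) ≡ true × w ≢ b ×
                  (Adj E b w ⊎ ∃[ x ] (S x ≡ A × Adj E b x × Adj E x w)))
    partner-B b sb χb with partner-B' (to b) (S'-to b ∙ sb) χb
    ... | w , χw , w≢b , inj₁ adj =
      from w , χ-from w χw , from-to-≢ w≢b , inj₁ (subst (λ z → Adj E z (from w)) (from-to b) (Adj-from adj))
    ... | w , χw , w≢b , inj₂ (x , sx , bx , xw) =
      from w , χ-from w χw , from-to-≢ w≢b ,
      inj₂ (from x , sx , subst (λ z → Adj E z (from x)) (from-to b) (Adj-from bx) , Adj-from xw)

  invariant : Invariant n E' S'
  invariant = record
    { blocks = blocks
    ; order = trans order (cong (5 * blocks +_) (sym leaves'))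
    ; count-A = count-A'
    ; B-nbr-A = λ b x sb adj → B-nbr-A (from b) (from x) sb (Adj-from adj)
    ; nonA-dom = nonA-dom' ; A-partner = A-partner' ; A-nonleaf = A-nonleaf'
    ; lower-bound = λ χ dom → subst (2 * blocks ≤_) (sym (card-to χ))
                                    (lower-bound (χ ∘ to) (pullback-dominating χ dom)) }

invariant : ∀ {n E S} → InFam n E S → Invariant n E S
invariant base            = base-invariant
invariant (op1 F v sv)    = O1-Preserves.invariant (invariant F) v sv
invariant (op2 F v sv dv) = O2-Preserves.invariant (invariant F) v sv dv
invariant (iso F σ)       = Iso-Preserves.invariant (invariant F) σ

module FromInvariant {n} {E : Edges n} {S : Labeling n} (I : Invariant n E S) where
  open Invariant I

  A-set : Subset n
  A-set = tabulate (isA ∘ S)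

  A-set-∈ : ∀ a → S a ≡ A → a ∈ A-set
  A-set-∈ a sa = lookup⇒[]= a A-set (lookup∘tabulate (isA ∘ S) a ∙ cong isA sa)

  A-set-status : ∀ a → a ∈ A-set → S a ≡ A
  A-set-status a a∈ = isA→≡A (S a) (sym (lookup∘tabulate (isA ∘ S) a) ∙ []=⇒lookup a∈)

  A-set-size : ∣ A-set ∣ ≡ 2 * blocks
  A-set-size = ∣∣≡card A-set ∙ sum-cong-≗ (cong bit ∘ lookup∘tabulate (isA ∘ S)) ∙ count-A

  A-set-semitotal : IsSemitotalDom E A-set
  A-set-semitotal = dominated , partnered
    where
    dominated : ∀ w → w ∉ A-set → ∃[ u ] (u ∈ A-set × Adj E w u)
    dominated w w∉ with nonA-dom w (w∉ ∘ A-set-∈ w)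
    ... | u , su , adj = u , A-set-∈ u su , adj
    partnered : ∀ w → w ∈ A-set → ∃[ u ] (u ∈ A-set × u ≢ w × (Adj E w u ⊎ ∃[ x ] (Adj E w x × Adj E x u)))
    partnered w w∈ with A-partner w (A-set-status w w∈)
    ... | a' , x , sa' , a'≢w , wx , xa' = a' , A-set-∈ a' sa' , a'≢w , inj₂ (x , wx , xa')

  -- A semitotal dominating set is A/B-dominating, since neighbours of B-vertices have status A.
  semitotal→ABDominating : ∀ D → IsSemitotalDom E D → ABDominating E S (lookup D)
  semitotal→ABDominating D (dominated , partnered) = abDominating dominates-A partner-B
    where
    dominates-A : ∀ a → S a ≡ A → ∃[ w ] (lookup D w ≡ true × (w ≡ a ⊎ Adj E a w))
    dominates-A a _ with lookup D a in Da
    ... | true  = a , Da , inj₁ refl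
    ... | false with dominated a (λ a∈ → false≢true (sym Da ∙ []=⇒lookup a∈))
    ...   | u , u∈ , adj = u , []=⇒lookup u∈ , inj₂ adj
    partner-B : ∀ b → S b ≡ B → lookup D b ≡ true → ∃[ w ] (lookup D w ≡ true × w ≢ b ×
                  (Adj E b w ⊎ ∃[ x ] (S x ≡ A × Adj E b x × Adj E x w)))
    partner-B b sb Db with partnered b (lookup⇒[]= b D Db)
    ... | w , w∈ , w≢b , inj₁ adj            = w , []=⇒lookup w∈ , w≢b , inj₁ adj
    ... | w , w∈ , w≢b , inj₂ (x , bx , xw) = w , []=⇒lookup w∈ , w≢b , inj₂ (x , B-nbr-A b x sb bx , bx , xw)

  minimum : ∀ D → IsSemitotalDom E D → 2 * blocks ≤ ∣ D ∣
  minimum D std = subst (2 * blocks ≤_) (sym (∣∣≡card D)) (lower-bound (lookup D) (semitotal→ABDominating D std))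

  formula : 5 * (2 * blocks) ≡ 2 * (n + 2 ∸ leaves E)
  formula = begin
    5 * (2 * blocks)                      ≡⟨ sym (*-assoc 5 2 blocks) ⟩
    10 * blocks                           ≡⟨ *-assoc 2 5 blocks ⟩
    2 * (5 * blocks)                      ≡⟨ cong (2 *_) (sym (m+n∸n≡m (5 * blocks) (leaves E))) ⟩
    2 * (5 * blocks + leaves E ∸ leaves E) ≡⟨ cong (λ t → 2 * (t ∸ leaves E)) (sym order) ⟩
    2 * (n + 2 ∸ leaves E)                ∎
    where open ≡-Reasoning

lemma2p4 : (n : ℕ) (E : Edges n) (S : Labeling n) → InFam n E S →
    ∃[ k ] (IsGammaT2 E k × 5 * k ≡ 2 * (n + 2 ∸ leaves E))
lemma2p4 n E S F =
  2 * blocks , ((A-set , A-set-semitotal , A-set-size) , minimum) , formula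
  where
  I : Invariant n E S
  I = invariant F
  open Invariant I using (blocks)
  open FromInvariant I
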